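{- The following hold: 1. $(T^{(0)}[F])^{\downarrow}=\{s\in W^\mathcal{U}\mid \{c\in\mathbb{F}^+\mid s^{ -1}[[\![c]\!]]\in\mathcal{U}\}\supseteq F\}$; 2. $(S^{(0)}[I])^{\uparrow}=\{t\in U^\mathcal{U}\mid \{c\in\mathbb{F}^+\mid t^{ -1}[(\![c]\!)]\in\mathcal{U}\}\supseteq I\}$.
   Context: $\mathbb{F}=(W,U,N,\{R_f\},\{R_g\})$ is an $\mathcal{L}$-frame; $\mathbb{F}^+$ its complex algebra, whose elements are concepts $c=([\![c]\!],(\![c]\!))$ with extension $[\![c]\!]\subseteq W$ and intension $(\![c]\!)\subseteq U$, $(\![c]\!)=[\![c]\!]^\uparrow$, $[\![c]\!]=(\![c]\!)^\downarrow$. $\mathcal{U}$ is an ultrafilter on a set $J$ such that the ultrapower $\mathbb{F}^J/\mathcal{U}$ is $|\mathcal{L}_\mathbb{F}|^+$-saturated ($\mathcal{L}_\mathbb{F}$ the two-sorted first-order language with $N$, the $R_f,R_g$, and unary predicates for each $[\![a]\!]$, $(\![a]\!)$, $a\in\mathbb{F}^+$); $W^\mathcal{U}$, $U^\mathcal{U}$ are its domains (classes of functions $s:J\to W$, $t:J\to U$), and $sN^\mathcal{U}t$ iff $\{j\mid s(j)Nt(j)\}\in\mathcal{U}$. The polarity maps $\uparrow,\downarrow$ in the claim are taken w.r.t. $N^\mathcal{U}$. $F$ ranges over filters and $I$ over ideals of $\mathbb{F}^+$. The relations $S\subseteq W^\mathcal{U}\times\{\text{ideals of }\mathbb{F}^+\}$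 and $T\subseteq U^\mathcal{U}\times\{\text{filters of }\mathbb{F}^+\}$ are defined by $sSI$ iff $s^{ -1}[[\![c]\!]]\in\mathcal{U}$ for some $c\in I$, and $tTF$ iff $t^{ -1}[(\![c]\!)]\in\mathcal{U}$ for some $c\in F$; $T^{(0)}[F]=\{t\mid tTF\}$, $S^{(0)}[I]=\{s\mid sSI\}$. -}

module Defs where

open import Level using (Level; 0ℓ)
open import Data.Unit using (⊤)
open import Data.Empty using (⊥)
open import Data.Product using (Σ; _×_; _,_; proj₁; proj₂)
open import Data.Sum using (_⊎_)
open import Relation.Nullary using (¬_)
open import Relation.Unary using (Pred; _⊆_; _∩_; ∁; _∈_)

upper : {ℓ : Level} {X Y : Set} (R : X → Y → Set) → Pred X ℓ → Pred Y ℓ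
upper R A y = ∀ x → A x → R x y

lower : {ℓ : Level} {X Y : Set} (R : X → Y → Set) → Pred Y ℓ → Pred X ℓ
lower R B x = ∀ y → B y → R x y

-- Concepts of the polarity (W, U, N): elements of the complex algebra F⁺.
-- ⟦c⟧ = ext c, ⦅c⦆ = int c, with ⦅c⦆ = ⟦c⟧↑ and ⟦c⟧ = ⦅c⦆↓.

record Concept {W U : Set} (N : W → U → Set) : Set₁ where
  field
    ext   : Pred W 0ℓ
    int   : Pred U 0ℓ
    int⊆  : int ⊆ upper N ext
    ⊆int  : upper N ext ⊆ int
    ext⊆  : ext ⊆ lower N int
    ⊆ext  : lower N int ⊆ ext
open Concept public

_≤C_ : {W U : Set} {N : W → U → Set} → Concept N → Concept N → Set
c ≤C d = ext c ⊆ ext d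

meetC : {W U : Set} {N : W → U → Set} → Concept N → Concept N → Concept N
meetC {N = N} c d = record
  { ext  = ext c ∩ ext d
  ; int  = upper N (ext c ∩ ext d)
  ; int⊆ = λ p → p
  ; ⊆int = λ p → p
  ; ext⊆ = λ w∈ y y∈ → y∈ _ w∈
  ; ⊆ext = λ {w} h →
      ( ⊆ext c (λ y y∈ → h y (λ x x∈ → int⊆ c y∈ x (proj₁ x∈)))
      , ⊆ext d (λ y y∈ → h y (λ x x∈ → int⊆ d y∈ x (proj₂ x∈))) )
  }

joinC : {W U : Set} {N : W → U → Set} → Concept N → Concept N → Concept N
joinC {N = N} c d = record
  { ext  = lower N (int c ∩ int d)
  ; int  = int c ∩ int d
  ; int⊆ = λ y∈ x x∈ → x∈ _ y∈
  ; ⊆int = λ {y} h →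
      ( ⊆int c (λ x x∈ → h x (λ y′ y′∈ → ext⊆ c x∈ y′ (proj₁ y′∈)))
      , ⊆int d (λ x x∈ → h x (λ y′ y′∈ → ext⊆ d x∈ y′ (proj₂ y′∈))) )
  ; ext⊆ = λ p → p
  ; ⊆ext = λ p → p
  }

record IsFilter {W U : Set} (N : W → U → Set) (F : Pred (Concept N) 0ℓ) : Set₁ where
  field
    nonempty : Σ (Concept N) F
    up-closed : ∀ c d → c ≤C d → F c → F d
    meet-closed : ∀ c d → F c → F d → F (meetC c d)

record IsIdeal {W U : Set} (N : W → U → Set) (I : Pred (Concept N) 0ℓ) : Set₁ where
  field
    nonempty : Σ (Concept N) I
    down-closed : ∀ c d → c ≤C d → I d → I c
    join-closed : ∀ c d → I c → I d → I (joinC c d)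

record IsUltrafilter (J : Set) (𝒰 : Pred (Pred J 0ℓ) 0ℓ) : Set₁ where
  field
    whole    : 𝒰 (λ _ → ⊤)
    proper   : ¬ 𝒰 (λ _ → ⊥)
    up-closed : ∀ X Y → X ⊆ Y → 𝒰 X → 𝒰 Y
    ∩-closed : ∀ X Y → 𝒰 X → 𝒰 Y → 𝒰 (X ∩ Y)
    ultra    : ∀ X → 𝒰 X ⊎ 𝒰 (∁ X)

-- Ultrapower.  Elements of W^𝒰, U^𝒰 are represented by functions J → W,
-- J → U (all notions below are invariant under 𝒰-a.e. equality).

_⁻¹[_] : {J X : Set} → (J → X) → Pred X 0ℓ → Pred J 0ℓ
(s ⁻¹[ A ]) j = A (s j)

NU : {J W U : Set} → Pred (Pred J 0ℓ) 0ℓ → (W → U → Set) → (J → W) → (J → U) → Set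
NU 𝒰 N s t = 𝒰 (λ j → N (s j) (t j))

S-rel : {J W U : Set} (𝒰 : Pred (Pred J 0ℓ) 0ℓ) (N : W → U → Set) →
        (J → W) → Pred (Concept N) 0ℓ → Set₁
S-rel 𝒰 N s I = Σ (Concept N) λ c → I c × 𝒰 (s ⁻¹[ ext c ])

T-rel : {J W U : Set} (𝒰 : Pred (Pred J 0ℓ) 0ℓ) (N : W → U → Set) →
        (J → U) → Pred (Concept N) 0ℓ → Set₁
T-rel 𝒰 N t F = Σ (Concept N) λ c → F c × 𝒰 (t ⁻¹[ int c ])

module Submission where

open import Defs
open import Level using (0ℓ)
open import Data.Empty using (⊥-elim)
open import Data.Product using (_×_; Σ; _,_; proj₁; proj₂)
open import Data.Sum using (inj₁; inj₂)
open import Function using (flip; const)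
open import Relation.Nullary using (¬_; yes; no)
open import Relation.Unary using (Pred; _⊆_; _≐_; Empty; Satisfiable)
open import Axiom.ExcludedMiddle using (ExcludedMiddle)
open import Axiom.DoubleNegationElimination using (em⇒dne)

-- For s in (T⁽⁰⁾[F])↓ and c ∈ F, suppose s⁻¹[⟦c⟧] ∉ 𝒰, so its complement is in 𝒰.
-- Since ⟦c⟧ = ⦅c⦆↓, at each j of the complement some point of ⦅c⦆ is not N-related
-- to s j; choosing one pointwise gives t with t T F, hence s N^𝒰 t, although the two
-- are N-unrelated on a set in 𝒰.  The second item is the first one for the converse
-- relation.  Neither argument uses that F is a filter or I an ideal.

module _ {J : Set} {𝒰 : Pred (Pred J 0ℓ) 0ℓ} (uf : IsUltrafilter J 𝒰) where
  open IsUltrafilter uf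

  𝒰-nonEmpty : {X : Pred J 0ℓ} → 𝒰 X → ¬ Empty X
  𝒰-nonEmpty {X} X∈𝒰 X-empty = proper (up-closed X _ (λ {j} → X-empty j) X∈𝒰)

  𝒰-satisfiable : ExcludedMiddle 0ℓ → {X : Pred J 0ℓ} → 𝒰 X → Satisfiable X
  𝒰-satisfiable em {X} X∈𝒰 with em {Satisfiable X}
  ... | yes sat = sat
  ... | no unsat = ⊥-elim (𝒰-nonEmpty X∈𝒰 (λ j x → unsat (j , x)))

  NU-intro : {W U : Set} {N : W → U → Set} (c : Concept N) (s : J → W) (t : J → U) →
             𝒰 (s ⁻¹[ ext c ]) → 𝒰 (t ⁻¹[ int c ]) → NU 𝒰 N s t
  NU-intro c s t s∈ext t∈int =
    up-closed _ _ (λ {j} (x∈ext , y∈int) → int⊆ c y∈int (s j) x∈ext) (∩-closed _ _ s∈ext t∈int)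

  module _ (em : ExcludedMiddle 0ℓ) {W U : Set} {N : W → U → Set}
           {A : Pred W 0ℓ} {B : Pred U 0ℓ} (B↓⊆A : lower N B ⊆ A) where

    separate : ∀ {x} → ¬ A x → Σ U λ y → B y × ¬ N x y
    separate {x} x∉A with em {Σ U λ y → B y × ¬ N x y}
    ... | yes witness = witness
    ... | no none = ⊥-elim (x∉A (B↓⊆A λ y b → em⇒dne em λ ¬Nxy → none (y , b , ¬Nxy)))

    separateWhereOutside : ∀ {x₀} → ¬ A x₀ → ∀ x → Σ U λ y → B y × (¬ A x → ¬ N x y)
    separateWhereOutside x₀∉A x with em {A x}
    ... | yes x∈A = let (y , b , _) = separate x₀∉A in y , b , λ x∉A → ⊥-elim (x∉A x∈A)
    ... | no x∉A  = let (y , b , ¬Nxy) = separate x∉A in y , b , const ¬Nxy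

    NU-lower⇒𝒰 : {s : J → W} → (∀ t → 𝒰 (t ⁻¹[ B ]) → NU 𝒰 N s t) → 𝒰 (s ⁻¹[ A ])
    NU-lower⇒𝒰 {s} s↓ with ultra (s ⁻¹[ A ])
    ... | inj₁ s∈A = s∈A
    ... | inj₂ s∉A = ⊥-elim (𝒰-nonEmpty (∩-closed _ _ s∉A (s↓ t t∈B))
                                        (λ j (x∉A , Nxy) → t-separates j x∉A Nxy))
      where
        choice : ∀ j → Σ U λ y → B y × (¬ A (s j) → ¬ N (s j) y)
        choice j = separateWhereOutside (proj₂ (𝒰-satisfiable em s∉A)) (s j)

        t : J → U
        t j = proj₁ (choice j)

        t∈B : 𝒰 (t ⁻¹[ B ])
        t∈B = up-closed _ _ (λ {j} _ → proj₁ (proj₂ (choice j))) whole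

        t-separates : ∀ j → ¬ A (s j) → ¬ N (s j) (t j)
        t-separates j = proj₂ (proj₂ (choice j))

  module _ (em : ExcludedMiddle 0ℓ) {W U : Set} (N : W → U → Set) where

    lower-T-rel : (F : Pred (Concept N) 0ℓ) →
                  lower (NU 𝒰 N) (λ t → T-rel 𝒰 N t F)
                    ≐ (λ s → ∀ c → F c → 𝒰 (s ⁻¹[ ext c ]))
    lower-T-rel F =
        (λ s↓ c c∈F → NU-lower⇒𝒰 em {N = N} (⊆ext c) (λ t t∈int → s↓ t (c , c∈F , t∈int)))
      , (λ {s} s∈ext t (c , c∈F , t∈int) → NU-intro c s t (s∈ext c c∈F) t∈int)

    upper-S-rel : (I : Pred (Concept N) 0ℓ) →
                  upper (NU 𝒰 N) (λ s → S-rel 𝒰 N s I)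
                    ≐ (λ t → ∀ c → I c → 𝒰 (t ⁻¹[ int c ]))
    upper-S-rel I =
        (λ t↑ c c∈I → NU-lower⇒𝒰 em {N = flip N} (⊆int c) (λ s s∈ext → t↑ s (c , c∈I , s∈ext)))
      , (λ {t} t∈int s (c , c∈I , s∈ext) → NU-intro c s t s∈ext (t∈int c c∈I))

mainTheorem8 : ExcludedMiddle 0ℓ →
    (W U : Set) (N : W → U → Set) (J : Set) (𝒰 : Pred (Pred J 0ℓ) 0ℓ) →
    IsUltrafilter J 𝒰 →
    ((F : Pred (Concept N) 0ℓ) → IsFilter N F →
      lower (NU 𝒰 N) (λ t → T-rel 𝒰 N t F)
        ≐ (λ s → ∀ c → F c → 𝒰 (s ⁻¹[ ext c ])))
    ×
    ((I : Pred (Concept N) 0ℓ) → IsIdeal N I →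
      upper (NU 𝒰 N) (λ s → S-rel 𝒰 N s I)
        ≐ (λ t → ∀ c → I c → 𝒰 (t ⁻¹[ int c ])))
mainTheorem8 em W U N J 𝒰 uf =
  (λ F _ → lower-T-rel uf em N F) , (λ I _ → upper-S-rel uf em N I)
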